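{- Let $s\ge 1$, $t\ge 2$, $p\ge 1$ and $n_1,\dots,n_t$ be positive integers with $n=\sum_{i=1}^{t} n_i + s$. If $n_1\geq n_2\geq \cdots \geq n_t\geq p$, $n_2 \geq 3$ and $n_1 < n-s-(t-2)p-3$, then $$|E(K_s\vee(K_{n_1}\cup K_{n_2}\cup \cdots \cup K_{n_t}))|< |E(K_s\vee (K_{n-s-(t-2)p-3} \cup K_3 \cup (t-2)K_p))|.$$
   Context: $|E(G)|$ is the number of edges of $G$. $K_m$ is the complete graph on $m$ vertices; $\cup$ is disjoint union; $G_1\vee G_2$ (join) is obtained from $G_1\cup G_2$ by adding all edges between $V(G_1)$ and $V(G_2)$; $aH$ denotes the disjoint union of $a$ copies of $H$. -}

module Defs where

open import Data.Nat using (ℕ; zero; suc; _+_; _<_)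
open import Data.Nat.Properties using (_<?_)
open import Data.Bool using (Bool; true; false; not; _∧_; if_then_else_)
open import Data.Fin using (Fin; toℕ; splitAt; _≟_)
open import Data.Sum using (_⊎_; inj₁; inj₂)
open import Data.List using (List; map; allFin)
open import Data.Nat.ListAction using (sum)
open import Data.Vec using (Vec; []; _∷_)
open import Relation.Nullary using (does)

-- A (simple) graph on vertex set Fin size, given by its adjacency relation.
-- All graphs built below are symmetric and loopless.
record Graph : Set where
  constructor mkGraph
  field
    size : ℕ
    adj  : Fin size → Fin size → Bool
open Graph public

edges : Graph → ℕ
edges (mkGraph m a) =
  sum (map (λ i → sum (map (λ j →
        if does (toℕ i <? toℕ j) ∧ a i j then 1 else 0) (allFin m))) (allFin m))

K : ℕ → Graph
K m = mkGraph m (λ i j → not (does (i ≟ j)))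

∅ᴳ : Graph
∅ᴳ = mkGraph 0 (λ ())

_∪ᴳ_ : Graph → Graph → Graph
G ∪ᴳ H = mkGraph (size G + size H) (λ i j → f (splitAt (size G) i) (splitAt (size G) j))
  where
  f : Fin (size G) ⊎ Fin (size H) → Fin (size G) ⊎ Fin (size H) → Bool
  f (inj₁ a) (inj₁ b) = adj G a b
  f (inj₂ a) (inj₂ b) = adj H a b
  f _ _ = false

_∨ᴳ_ : Graph → Graph → Graph
G ∨ᴳ H = mkGraph (size G + size H) (λ i j → f (splitAt (size G) i) (splitAt (size G) j))
  where
  f : Fin (size G) ⊎ Fin (size H) → Fin (size G) ⊎ Fin (size H) → Bool
  f (inj₁ a) (inj₁ b) = adj G a b
  f (inj₂ a) (inj₂ b) = adj H a b
  f _ _ = true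

infixr 6 _∪ᴳ_
infixr 5 _∨ᴳ_

copies : ℕ → Graph → Graph
copies zero H = ∅ᴳ
copies (suc a) H = H ∪ᴳ copies a H

unionK : ∀ {t} → Vec ℕ t → Graph
unionK [] = ∅ᴳ
unionK (m ∷ ms) = K m ∪ᴳ unionK ms

{-# OPTIONS --safe #-}
module Submission where

-- Both graphs have n − s vertices outside K_s, so the two joins differ only in the edges of the
-- clique unions. Moving e vertices out of a clique of size b + e into a clique of size a ≥ b + e
-- gains (a − b)e ≥ e edges and keeps the receiving clique the largest. Starting from K_{n_1}, absorb
-- the excess n_2 − 3 and every excess n_i − p (i ≥ 3): this yields K_N ∪ K_3 ∪ (t−2)K_p with
-- N = n − s − (t−2)p − 3, and gains at least N − n_1 > 0 edges.

open import Defs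
open import Data.Nat using (ℕ; zero; suc; _+_; _*_; _∸_; _≤_; _<_; _≥_; z≤n)
open import Data.Nat.Properties
  using ( +-0-commutativeMonoid; +-assoc; _<?_; +-identityʳ; *-identityˡ; *-identityʳ; *-distribʳ-+
        ; +-monoʳ-≤; +-monoˡ-≤; +-monoʳ-<; *-monoˡ-≤; +-cancelˡ-<
        ; m≤m+n; m≤m*n; m<m+n; m≤n⇒m≤n+o; m+n∸n≡m; m≤n⇒∃[o]m+o≡n
        ; +-comm; ∸-+-assoc; <⇒≤; <⇒≱; <-≤-trans; ≤-reflexive; module ≤-Reasoning )
open import Data.Nat.Combinatorics using (_C_; nC1≡n; nCk+nC[k+1]≡[n+1]C[k+1])
open import Data.Nat.Tactic.RingSolver using (solve-∀)
open import Data.Bool using (Bool; true; false; _∧_; if_then_else_)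
open import Data.Fin using (Fin; zero; suc; toℕ; _↑ˡ_; _↑ʳ_) renaming (_≤_ to _≤ᶠ_)
open import Data.Fin.Properties using (toℕ-↑ˡ; toℕ-↑ʳ; toℕ<n; splitAt-↑ˡ; splitAt-↑ʳ)
import Data.List as List
open import Data.List using (allFin)
open import Data.List.Properties using (map-tabulate)
open import Data.Nat.ListAction using () renaming (sum to sumᴸ)
open import Data.Vec using (Vec; []; _∷_; lookup; sum; map; replicate)
open import Data.Vec.Properties using (lookup-replicate)
open import Data.Product using (∃-syntax; _×_; _,_)
open import Function using (id; _∘_; mk⇔)
open import Relation.Nullary using (does)
open import Relation.Nullary.Decidable using (dec-true; dec-false; does-⇔)
open import Relation.Binary.PropositionalEquality
  using (_≡_; refl; sym; trans; cong; cong₂; subst; subst₂; module ≡-Reasoning)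
open import Algebra.Properties.CommutativeMonoid.Sum +-0-commutativeMonoid
  using (sum-syntax; ∑-distrib-+; sum-cong-≗; sum-replicate-zero)

sum-tabulate : ∀ {m} (f : Fin m → ℕ) → sumᴸ (List.tabulate f) ≡ ∑[ i < m ] f i
sum-tabulate {zero}  f = refl
sum-tabulate {suc m} f = cong (f zero +_) (sum-tabulate (f ∘ suc))

sum-map-allFin : ∀ {m} (f : Fin m → ℕ) → sumᴸ (List.map f (allFin m)) ≡ ∑[ i < m ] f i
sum-map-allFin f = trans (cong sumᴸ (map-tabulate id f)) (sum-tabulate f)

∑-const : ∀ m c → ∑[ i < m ] c ≡ m * c
∑-const zero    c = refl
∑-const (suc m) c = cong (c +_) (∑-const m c)

∑-↑ : ∀ m n (f : Fin (m + n) → ℕ) →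
      ∑[ i < m + n ] f i ≡ ∑[ i < m ] f (i ↑ˡ n) + ∑[ j < n ] f (m ↑ʳ j)
∑-↑ zero    n f = refl
∑-↑ (suc m) n f = trans (cong (f zero +_) (∑-↑ m n (f ∘ suc))) (sym (+-assoc (f zero) _ _))

∑∑-cong : ∀ {k l} {f g : Fin k → Fin l → ℕ} → (∀ i j → f i j ≡ g i j) →
          ∑[ i < k ] ∑[ j < l ] f i j ≡ ∑[ i < k ] ∑[ j < l ] g i j
∑∑-cong f≗g = sum-cong-≗ (λ i → sum-cong-≗ (f≗g i))

∑∑-zero : ∀ k l → ∑[ i < k ] ∑[ j < l ] 0 ≡ 0
∑∑-zero k l = trans (sum-cong-≗ {k} (λ _ → sum-replicate-zero l)) (sum-replicate-zero k)

∑∑-one : ∀ k l → ∑[ i < k ] ∑[ j < l ] 1 ≡ k * l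
∑∑-one k l = trans (sum-cong-≗ {k} (λ _ → ∑-const l 1)) (trans (∑-const k (l * 1)) (cong (k *_) (*-identityʳ l)))

countPair : ∀ {m} → (Fin m → Fin m → Bool) → Fin m → Fin m → ℕ
countPair a i j = if does (toℕ i <? toℕ j) ∧ a i j then 1 else 0

edges-∑ : ∀ m (a : Fin m → Fin m → Bool) →
          edges (mkGraph m a) ≡ ∑[ i < m ] ∑[ j < m ] countPair a i j
edges-∑ m a = trans (sum-map-allFin (λ i → sumᴸ (List.map (countPair a i) (allFin m))))
                    (sum-cong-≗ (λ i → sum-map-allFin (countPair a i)))

∑∑-↑ : ∀ m n (f : Fin (m + n) → Fin (m + n) → ℕ) →
  ∑[ i < m + n ] ∑[ j < m + n ] f i j
    ≡ (∑[ i < m ] ∑[ j < m ] f (i ↑ˡ n) (j ↑ˡ n) + ∑[ i < m ] ∑[ j < n ] f (i ↑ˡ n) (m ↑ʳ j))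
      + (∑[ i < n ] ∑[ j < m ] f (m ↑ʳ i) (j ↑ˡ n) + ∑[ i < n ] ∑[ j < n ] f (m ↑ʳ i) (m ↑ʳ j))
∑∑-↑ m n f = trans (∑-↑ m n _) (cong₂ _+_ (split-inner (λ i → f (i ↑ˡ n))) (split-inner (λ i → f (m ↑ʳ i))))
  where
  split-inner : ∀ {k} (g : Fin k → Fin (m + n) → ℕ) →
    ∑[ i < k ] ∑[ j < m + n ] g i j ≡ ∑[ i < k ] ∑[ j < m ] g i (j ↑ˡ n) + ∑[ i < k ] ∑[ j < n ] g i (m ↑ʳ j)
  split-inner g = trans (sum-cong-≗ (λ i → ∑-↑ m n (g i)))
                        (∑-distrib-+ (λ i → ∑[ j < m ] g i (j ↑ˡ n)) (λ i → ∑[ j < n ] g i (m ↑ʳ j)))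

edges-blocks : ∀ m n (A : Fin (m + n) → Fin (m + n) → Bool) {a : Fin m → Fin m → Bool} {b : Fin n → Fin n → Bool}
  (c : Bool) → (∀ i j → A (i ↑ˡ n) (j ↑ˡ n) ≡ a i j) → (∀ i j → A (m ↑ʳ i) (m ↑ʳ j) ≡ b i j) →
  (∀ i j → A (i ↑ˡ n) (m ↑ʳ j) ≡ c) →
  edges (mkGraph (m + n) A) ≡ edges (mkGraph m a) + (if c then m * n else 0) + edges (mkGraph n b)
edges-blocks m n A {a} {b} c A≗a A≗b A≗c =
  trans (edges-∑ (m + n) A) (trans (∑∑-↑ m n (countPair A))
    (cong₂ _+_ (cong₂ _+_ (trans (∑∑-cong first) (sym (edges-∑ m a))) (trans (∑∑-cong crossing) (crossings c)))
               (cong₂ _+_ (trans (∑∑-cong backward) (∑∑-zero n m)) (trans (∑∑-cong second) (sym (edges-∑ n b))))))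
  where
  first : ∀ i j → countPair A (i ↑ˡ n) (j ↑ˡ n) ≡ countPair a i j
  first i j rewrite toℕ-↑ˡ i n | toℕ-↑ˡ j n | A≗a i j = refl

  second : ∀ i j → countPair A (m ↑ʳ i) (m ↑ʳ j) ≡ countPair b i j
  second i j rewrite toℕ-↑ʳ m i | toℕ-↑ʳ m j | A≗b i j
    | does-⇔ (mk⇔ (+-cancelˡ-< m (toℕ i) (toℕ j)) (+-monoʳ-< m)) (m + toℕ i <? m + toℕ j) (toℕ i <? toℕ j) = refl

  crossing : ∀ i j → countPair A (i ↑ˡ n) (m ↑ʳ j) ≡ (if c then 1 else 0)
  crossing i j rewrite toℕ-↑ˡ i n | toℕ-↑ʳ m j | A≗c i j
    | dec-true (toℕ i <? m + toℕ j) (<-≤-trans (toℕ<n i) (m≤m+n m (toℕ j))) = refl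

  backward : ∀ i j → countPair A (m ↑ʳ i) (j ↑ˡ n) ≡ 0
  backward i j rewrite toℕ-↑ʳ m i | toℕ-↑ˡ j n
    | dec-false (m + toℕ i <? toℕ j) (λ lt → <⇒≱ lt (m≤n⇒m≤n+o (toℕ i) (<⇒≤ (toℕ<n j)))) = refl

  crossings : ∀ c → ∑[ i < m ] ∑[ j < n ] (if c then 1 else 0) ≡ (if c then m * n else 0)
  crossings true  = ∑∑-one m n
  crossings false = ∑∑-zero m n

edges-∪ : ∀ G H → edges (G ∪ᴳ H) ≡ edges G + edges H
edges-∪ G H = trans (edges-blocks (size G) (size H) (adj (G ∪ᴳ H)) false left right crossing)
                    (cong (_+ edges H) (+-identityʳ (edges G)))
  where
  left : ∀ i j → adj (G ∪ᴳ H) (i ↑ˡ size H) (j ↑ˡ size H) ≡ adj G i j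
  left i j rewrite splitAt-↑ˡ (size G) i (size H) | splitAt-↑ˡ (size G) j (size H) = refl
  right : ∀ i j → adj (G ∪ᴳ H) (size G ↑ʳ i) (size G ↑ʳ j) ≡ adj H i j
  right i j rewrite splitAt-↑ʳ (size G) (size H) i | splitAt-↑ʳ (size G) (size H) j = refl
  crossing : ∀ i j → adj (G ∪ᴳ H) (i ↑ˡ size H) (size G ↑ʳ j) ≡ false
  crossing i j rewrite splitAt-↑ˡ (size G) i (size H) | splitAt-↑ʳ (size G) (size H) j = refl

edges-∨ : ∀ G H → edges (G ∨ᴳ H) ≡ edges G + size G * size H + edges H
edges-∨ G H = edges-blocks (size G) (size H) (adj (G ∨ᴳ H)) true left right crossing
  where
  left : ∀ i j → adj (G ∨ᴳ H) (i ↑ˡ size H) (j ↑ˡ size H) ≡ adj G i j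
  left i j rewrite splitAt-↑ˡ (size G) i (size H) | splitAt-↑ˡ (size G) j (size H) = refl
  right : ∀ i j → adj (G ∨ᴳ H) (size G ↑ʳ i) (size G ↑ʳ j) ≡ adj H i j
  right i j rewrite splitAt-↑ʳ (size G) (size H) i | splitAt-↑ʳ (size G) (size H) j = refl
  crossing : ∀ i j → adj (G ∨ᴳ H) (i ↑ˡ size H) (size G ↑ʳ j) ≡ true
  crossing i j rewrite splitAt-↑ˡ (size G) i (size H) | splitAt-↑ʳ (size G) (size H) j = refl

C₂-suc : ∀ m → suc m C 2 ≡ m + m C 2
C₂-suc m = trans (sym (nCk+nC[k+1]≡[n+1]C[k+1] m 1)) (cong (_+ m C 2) (nC1≡n m))

edges-K : ∀ m → edges (K m) ≡ m C 2
edges-K zero    = refl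
edges-K (suc m) = begin
  edges (K (1 + m))    ≡⟨ edges-blocks 1 m (adj (K (1 + m))) true (λ _ _ → refl) (λ _ _ → refl) (λ { zero _ → refl }) ⟩
  1 * m + edges (K m)  ≡⟨ cong₂ _+_ (*-identityˡ m) (edges-K m) ⟩
  m + m C 2            ≡⟨ C₂-suc m ⟨
  suc m C 2            ∎
  where open ≡-Reasoning

∑C₂ : ∀ {k} → Vec ℕ k → ℕ
∑C₂ xs = sum (map (_C 2) xs)

size-unionK : ∀ {k} (xs : Vec ℕ k) → size (unionK xs) ≡ sum xs
size-unionK []       = refl
size-unionK (x ∷ xs) = cong (x +_) (size-unionK xs)

edges-unionK : ∀ {k} (xs : Vec ℕ k) → edges (unionK xs) ≡ ∑C₂ xs
edges-unionK []       = refl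
edges-unionK (x ∷ xs) = trans (edges-∪ (K x) (unionK xs)) (cong₂ _+_ (edges-K x) (edges-unionK xs))

copies-K≡unionK-replicate : ∀ k p → copies k (K p) ≡ unionK (replicate k p)
copies-K≡unionK-replicate zero    p = refl
copies-K≡unionK-replicate (suc k) p = cong (K p ∪ᴳ_) (copies-K≡unionK-replicate k p)

sum-replicate : ∀ k x → sum (replicate k x) ≡ k * x
sum-replicate zero    x = refl
sum-replicate (suc k) x = cong (x +_) (sum-replicate k x)

edges-∨-< : ∀ F {G H} → size G ≡ size H → edges G < edges H → edges (F ∨ᴳ G) < edges (F ∨ᴳ H)
edges-∨-< F {G} {H} |G|≡|H| G<H = begin-strict
  edges (F ∨ᴳ G)                      ≡⟨ edges-∨ F G ⟩
  edges F + size F * size G + edges G <⟨ +-monoʳ-< (edges F + size F * size G) G<H ⟩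
  edges F + size F * size G + edges H ≡⟨ cong (λ x → edges F + size F * x + edges H) |G|≡|H| ⟩
  edges F + size F * size H + edges H ≡⟨ edges-∨ F H ⟨
  edges (F ∨ᴳ H)                      ∎
  where open ≤-Reasoning

C₂-+ : ∀ m n → (m + n) C 2 ≡ m C 2 + m * n + n C 2
C₂-+ zero    n = refl
C₂-+ (suc m) n = begin
  suc (m + n) C 2               ≡⟨ C₂-suc (m + n) ⟩
  m + n + (m + n) C 2           ≡⟨ cong (m + n +_) (C₂-+ m n) ⟩
  m + n + (m C 2 + m * n + n C 2) ≡⟨ rearrange m n (m C 2) (m * n) (n C 2) ⟩
  m + m C 2 + (n + m * n) + n C 2 ≡⟨ cong (λ x → x + (n + m * n) + n C 2) (C₂-suc m) ⟨
  suc m C 2 + suc m * n + n C 2 ∎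
  where
  open ≡-Reasoning
  rearrange : ∀ m n u v w → m + n + (u + v + w) ≡ m + u + (n + v) + w
  rearrange = solve-∀

C₂-absorb : ∀ a b e → b + e ≤ a → a C 2 + (b + e) C 2 + e ≤ (a + e) C 2 + b C 2
C₂-absorb a b e b+e≤a = begin
  a C 2 + (b + e) C 2 + e             ≡⟨ cong (λ x → a C 2 + x + e) (C₂-+ b e) ⟩
  a C 2 + (b C 2 + b * e + e C 2) + e ≡⟨ rearrangeˡ (a C 2) (b C 2) (b * e) (e C 2) e ⟩
  a C 2 + e C 2 + b C 2 + (b * e + e) ≤⟨ +-monoʳ-≤ (a C 2 + e C 2 + b C 2) be+e≤ae ⟩
  a C 2 + e C 2 + b C 2 + a * e       ≡⟨ rearrangeʳ (a C 2) (e C 2) (b C 2) (a * e) ⟩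
  a C 2 + a * e + e C 2 + b C 2       ≡⟨ cong (_+ b C 2) (C₂-+ a e) ⟨
  (a + e) C 2 + b C 2                 ∎
  where
  open ≤-Reasoning
  m≤m*m : ∀ m → m ≤ m * m
  m≤m*m zero        = z≤n
  m≤m*m m@(suc _) = m≤m*n m m
  be+e≤ae : b * e + e ≤ a * e
  be+e≤ae = begin
    b * e + e     ≤⟨ +-monoʳ-≤ (b * e) (m≤m*m e) ⟩
    b * e + e * e ≡⟨ *-distribʳ-+ e b e ⟨
    (b + e) * e   ≤⟨ *-monoˡ-≤ e b+e≤a ⟩
    a * e         ∎
  rearrangeˡ : ∀ u v w x y → u + (v + w + x) + y ≡ u + x + v + (w + y)
  rearrangeˡ = solve-∀
  rearrangeʳ : ∀ u v w x → u + v + w + x ≡ u + x + v + w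
  rearrangeʳ = solve-∀

∑C₂-absorb : ∀ {k} a (bs xs : Vec ℕ k) →
  (∀ i → lookup bs i ≤ lookup xs i) → (∀ i → lookup xs i ≤ a) →
  ∃[ d ] sum xs ≡ sum bs + d × ∑C₂ (a ∷ xs) + d ≤ ∑C₂ ((a + d) ∷ bs)
∑C₂-absorb a [] [] _ _ =
  0 , refl , ≤-reflexive (trans (+-identityʳ _) (cong (λ x → x C 2 + 0) (sym (+-identityʳ a))))
∑C₂-absorb a (b ∷ bs) (x ∷ xs) bs≤xs xs≤a with m≤n⇒∃[o]m+o≡n (bs≤xs zero)
... | e , refl with ∑C₂-absorb (a + e) bs xs (bs≤xs ∘ suc) (λ i → m≤n⇒m≤n+o e (xs≤a (suc i)))
... | d , sum≡ , more = e + d , trans (cong (b + e +_) sum≡) (rearrange-sum b e (sum bs) d) , more′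
  where
  open ≤-Reasoning
  more′ : a C 2 + ((b + e) C 2 + ∑C₂ xs) + (e + d) ≤ (a + (e + d)) C 2 + (b C 2 + ∑C₂ bs)
  more′ = begin
    a C 2 + ((b + e) C 2 + ∑C₂ xs) + (e + d) ≡⟨ rearrange₁ (a C 2) ((b + e) C 2) (∑C₂ xs) e d ⟩
    a C 2 + (b + e) C 2 + e + (∑C₂ xs + d)   ≤⟨ +-monoˡ-≤ (∑C₂ xs + d) (C₂-absorb a b e (xs≤a zero)) ⟩
    (a + e) C 2 + b C 2 + (∑C₂ xs + d)       ≡⟨ rearrange₂ ((a + e) C 2) (b C 2) (∑C₂ xs) d ⟩
    (a + e) C 2 + ∑C₂ xs + d + b C 2         ≤⟨ +-monoˡ-≤ (b C 2) more ⟩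
    (a + e + d) C 2 + ∑C₂ bs + b C 2         ≡⟨ cong (λ y → y C 2 + ∑C₂ bs + b C 2) (+-assoc a e d) ⟩
    (a + (e + d)) C 2 + ∑C₂ bs + b C 2       ≡⟨ rearrange₃ ((a + (e + d)) C 2) (∑C₂ bs) (b C 2) ⟩
    (a + (e + d)) C 2 + (b C 2 + ∑C₂ bs)     ∎
    where
    rearrange₁ : ∀ u v w y z → u + (v + w) + (y + z) ≡ u + v + y + (w + z)
    rearrange₁ = solve-∀
    rearrange₂ : ∀ u v w z → u + v + (w + z) ≡ u + w + z + v
    rearrange₂ = solve-∀
    rearrange₃ : ∀ u v w → u + v + w ≡ u + (w + v)
    rearrange₃ = solve-∀
  rearrange-sum : ∀ b e s d → b + e + (s + d) ≡ b + s + (e + d)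
  rearrange-sum = solve-∀

edges-∨-unionK-< : ∀ F {k} a N (bs xs : Vec ℕ k) →
  (∀ i → lookup bs i ≤ lookup xs i) → (∀ i → lookup xs i ≤ a) →
  a < N → N ≡ a + sum xs ∸ sum bs →
  edges (F ∨ᴳ unionK (a ∷ xs)) < edges (F ∨ᴳ unionK (N ∷ bs))
edges-∨-unionK-< F a N bs xs bs≤xs xs≤a a<N N≡ with ∑C₂-absorb a bs xs bs≤xs xs≤a
... | d , sum≡ , more = edges-∨-< F sizes fewer-edges
  where
  rearrange : ∀ a s d → a + (s + d) ≡ a + d + s
  rearrange = solve-∀
  N≡a+d : N ≡ a + d
  N≡a+d = begin
    N                          ≡⟨ N≡ ⟩
    a + sum xs ∸ sum bs        ≡⟨ cong (λ y → a + y ∸ sum bs) sum≡ ⟩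
    a + (sum bs + d) ∸ sum bs  ≡⟨ cong (_∸ sum bs) (rearrange a (sum bs) d) ⟩
    a + d + sum bs ∸ sum bs    ≡⟨ m+n∸n≡m (a + d) (sum bs) ⟩
    a + d                      ∎
    where open ≡-Reasoning
  0<d : 0 < d
  0<d = +-cancelˡ-< a 0 d (subst₂ _<_ (sym (+-identityʳ a)) N≡a+d a<N)
  sizes : size (unionK (a ∷ xs)) ≡ size (unionK (N ∷ bs))
  sizes = begin
    size (unionK (a ∷ xs))  ≡⟨ size-unionK (a ∷ xs) ⟩
    a + sum xs              ≡⟨ cong (a +_) sum≡ ⟩
    a + (sum bs + d)        ≡⟨ rearrange a (sum bs) d ⟩
    a + d + sum bs          ≡⟨ cong (_+ sum bs) N≡a+d ⟨
    N + sum bs              ≡⟨ size-unionK (N ∷ bs) ⟨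
    size (unionK (N ∷ bs))  ∎
    where open ≡-Reasoning
  fewer-edges : edges (unionK (a ∷ xs)) < edges (unionK (N ∷ bs))
  fewer-edges = begin-strict
    edges (unionK (a ∷ xs))  ≡⟨ edges-unionK (a ∷ xs) ⟩
    ∑C₂ (a ∷ xs)             <⟨ m<m+n (∑C₂ (a ∷ xs)) 0<d ⟩
    ∑C₂ (a ∷ xs) + d         ≤⟨ more ⟩
    ∑C₂ ((a + d) ∷ bs)       ≡⟨ cong (λ y → ∑C₂ (y ∷ bs)) N≡a+d ⟨
    ∑C₂ (N ∷ bs)             ≡⟨ edges-unionK (N ∷ bs) ⟨
    edges (unionK (N ∷ bs))  ∎
    where open ≤-Reasoning

lemma2p6 : (s k p n : ℕ) (ns : Vec ℕ (2 + k)) →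
    s ≥ 1 → p ≥ 1 →
    (∀ i → 1 ≤ lookup ns i) →
    n ≡ sum ns + s →
    (∀ (i j : Fin (2 + k)) → i ≤ᶠ j → lookup ns j ≤ lookup ns i) →
    (∀ i → p ≤ lookup ns i) →
    lookup ns (suc zero) ≥ 3 →
    lookup ns zero < n ∸ s ∸ k * p ∸ 3 →
    edges (K s ∨ᴳ unionK ns)
      < edges (K s ∨ᴳ (K (n ∸ s ∸ k * p ∸ 3) ∪ᴳ K 3 ∪ᴳ copies k (K p)))
lemma2p6 s k p n ns@(a ∷ b ∷ rest) _ _ _ n≡ sorted p≤ 3≤b a<N =
  subst (λ G → edges (K s ∨ᴳ unionK ns) < edges (K s ∨ᴳ (K N ∪ᴳ K 3 ∪ᴳ G)))
        (sym (copies-K≡unionK-replicate k p))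
        (edges-∨-unionK-< (K s) a N (3 ∷ replicate k p) (b ∷ rest)
          bases≤parts (λ i → sorted zero (suc i) z≤n) a<N N≡)
  where
  N : ℕ
  N = n ∸ s ∸ k * p ∸ 3
  bases≤parts : ∀ i → lookup (3 ∷ replicate k p) i ≤ lookup (b ∷ rest) i
  bases≤parts zero    = 3≤b
  bases≤parts (suc i) = subst (_≤ lookup rest i) (sym (lookup-replicate i p)) (p≤ (suc (suc i)))
  N≡ : N ≡ sum ns ∸ (3 + sum (replicate k p))
  N≡ = begin
    n ∸ s ∸ k * p ∸ 3           ≡⟨ cong (λ m → m ∸ s ∸ k * p ∸ 3) n≡ ⟩
    sum ns + s ∸ s ∸ k * p ∸ 3  ≡⟨ cong (λ m → m ∸ k * p ∸ 3) (m+n∸n≡m (sum ns) s) ⟩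
    sum ns ∸ k * p ∸ 3          ≡⟨ ∸-+-assoc (sum ns) (k * p) 3 ⟩
    sum ns ∸ (k * p + 3)        ≡⟨ cong (sum ns ∸_) (trans (+-comm (k * p) 3) (cong (3 +_) (sym (sum-replicate k p)))) ⟩
    sum ns ∸ (3 + sum (replicate k p)) ∎
    where open ≡-Reasoning
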